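{- Let $s \geq 1$ and $t \geq 2$ be integers and let $\beta_{s,t}$ be the type-$\beta$ comb with $s$ teeth of length $t$. Then the number of linear extensions of $\beta_{s,t}$ that avoid both patterns $213$ and $312$ equals $2^{s-1}$.
   Context: A linear extension of a finite poset $P$ on a set of integers is a listing $v=[v_1,\dots,v_n]$ of all elements of $P$, each exactly once, such that whenever $a \leq_P b$, $a$ appears before $b$. For $w \in S_3$, a sequence $v$ of distinct integers contains $w$ if there are indices $i<j<k$ with $(v_i,v_j,v_k)$ in the same relative order as $(w_1,w_2,w_3)$; otherwise $v$ avoids $w$. The type-$\beta$ comb $\beta_{s,t}$ is the poset on $\{1,\dots,st\}$ whose order is generated by the relations $ct+1 \leq (c+1)t+1$ for $0 \leq c \leq s-2$ (the spine) and $ct+j \leq ct+j+1$ for $0 \leq c \leq s-1$, $1 \leq j \leq t-1$ (the teeth $\{ct+1,\dots,ct+t\}$). -}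

module Defs where

open import Data.Nat using (ℕ; zero; suc; _+_; _*_; _≤_; _<_)
open import Data.List using (List; length; lookup; upTo; map)
open import Data.List.Relation.Binary.Permutation.Propositional using (_↭_)
open import Data.Fin using (Fin; toℕ)
open import Data.Empty using (⊥)
open import Data.Product using (_×_; ∃-syntax)
open import Relation.Binary.PropositionalEquality using (_≡_)
open import Relation.Binary.Construct.Closure.ReflexiveTransitive using (Star)

-- Generating (cover) relations of the type-β comb β_{s,t} on {1,…,st}.
data CombGen (s t : ℕ) : ℕ → ℕ → Set where
  spine : ∀ c → suc c < s → CombGen s t (c * t + 1) (suc c * t + 1)
  tooth : ∀ c j → c < s → 1 ≤ j → j < t → CombGen s t (c * t + j) (c * t + suc j)

_≤β[_,_]_ : ℕ → ℕ → ℕ → ℕ → Set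
a ≤β[ s , t ] b = Star (CombGen s t) a b

range1 : ℕ → List ℕ
range1 n = map suc (upTo n)

IsLinExt : ℕ → ℕ → List ℕ → Set
IsLinExt s t v =
  (v ↭ range1 (s * t)) ×
  (∀ (i j : Fin (length v)) → lookup v i ≤β[ s , t ] lookup v j → toℕ i ≤ toℕ j)

Contains : (ℕ → ℕ → ℕ → Set) → List ℕ → Set
Contains R v = ∃[ i ] ∃[ j ] ∃[ k ]
  (toℕ i < toℕ j × toℕ j < toℕ k × R (lookup v i) (lookup v j) (lookup v k))

Pat213 : ℕ → ℕ → ℕ → Set
Pat213 a b c = b < a × a < c

Pat312 : ℕ → ℕ → ℕ → Set
Pat312 a b c = b < c × c < a

Avoids213-312 : List ℕ → Set
Avoids213-312 v = (Contains Pat213 v → ⊥) × (Contains Pat312 v → ⊥)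

-- A 213/312-avoiding sequence of distinct numbers has no "valley" v_j < v_i, v_k (i < j < k), so it
-- increases up to its maximum s t and decreases afterwards.  In β_{s,t} every non-multiple x of t is
-- covered by x + 1, which is larger, so it cannot sit in the decreasing tail; the tail is therefore a
-- decreasing list of tooth tops t, 2t, …, (s-1)t, and the increasing head is forced.  Conversely, for
-- any set B of such tops, listing the other elements increasingly, then s t, then B decreasingly is a
-- linear extension (the tops are maximal) without valleys.  So the extensions correspond to the 2^{s-1}
-- subsets B.

module Submission where

open import Defs
open import Level using (0ℓ)
open import Data.Nat using (ℕ; zero; suc; _+_; _*_; _<_; _>_; _≤_; _^_; _∸_; z<s; s<s; s<s⁻¹; NonZero; >-nonZero)
open import Data.Nat.Properties
  using (_≟_; ≤-refl; ≤-trans; <-trans; ≤-<-trans; <⇒≤; <⇒≢; >⇒≢; <⇒≱; ≮⇒≥; ≤∧≢⇒<; <-irrefl; <-asym; <-cmp;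
         n<1+n; m<n+m; m≤m+n; n≢0⇒n>0; +-comm; +-suc; +-identityʳ; +-monoʳ-<; +-monoˡ-<; *-monoˡ-<; *-cancelʳ-<)
open import Data.Nat.Divisibility using (_∣_; _∣?_; divides; ∣m+n∣m⇒∣n; n∣m*n; ∣⇒≤; m%n≡0⇒n∣m)
open import Data.Nat.DivMod using (_/_; _%_; m≡m%n+[m/n]*n; m%n<n)
open import Data.Fin using (toℕ; zero; suc)
open import Data.List using (List; []; _∷_; _++_; [_]; map; filter; length; lookup; applyDownFrom)
open import Data.List.Properties using (++-assoc; length-++; length-map; length-applyDownFrom; ∷-injectiveˡ; ∷-injectiveʳ)
open import Data.List.Relation.Unary.All as All using (All; []; _∷_)
import Data.List.Relation.Unary.All.Properties as All
open import Data.List.Relation.Unary.AllPairs as AllPairs using (AllPairs; []; _∷_)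
import Data.List.Relation.Unary.AllPairs.Properties as AllPairs
open import Data.List.Relation.Unary.Any using (here; there)
open import Data.List.Relation.Unary.Unique.Propositional using (Unique)
import Data.List.Relation.Unary.Unique.Propositional.Properties as Unique
open import Data.List.Membership.Propositional using (_∈_; _∉_)
open import Data.List.Membership.Propositional.Properties
  using (∈-lookup; ∈-++⁺ˡ; ∈-++⁺ʳ; ∈-++⁻; ∈-∃++; ∈-map⁺; ∈-map⁻; ∈-filter⁺; ∈-filter⁻; ∈-upTo⁺; ∈-upTo⁻;
         ∈-applyDownFrom⁺; ∈-applyDownFrom⁻)
open import Data.List.Membership.Propositional.Properties.WithK using (unique∧set⇒bag)
open import Data.List.Membership.DecPropositional _≟_ using (_∈?_; _∉?_)
open import Data.List.Relation.Binary.Sublist.Propositional using (_⊆_; []; _∷_; _∷ʳ_; minimum; ⊆-antisym)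
import Data.List.Relation.Binary.Sublist.Propositional as Sublist
open import Data.List.Relation.Binary.Sublist.Propositional.Properties using (All-resp-⊆)
open import Data.List.Relation.Binary.Permutation.Propositional using (_↭_; ↭-sym)
open import Data.List.Relation.Binary.Permutation.Propositional.Properties using (∈-resp-↭)
open import Data.List.Relation.Binary.BagAndSetEquality using (∼bag⇒↭)
open import Data.Product using (_×_; _,_; proj₁; proj₂; uncurry; ∃-syntax)
open import Data.Sum using (inj₁; inj₂)
open import Function.Base using (_∘_; id)
open import Function.Bundles using (_⇔_; mk⇔; Equivalence)
open import Relation.Binary.Core using (Rel)
open import Relation.Binary.Definitions using (Asymmetric; tri<; tri≈; tri>)
open import Relation.Binary.Construct.Closure.ReflexiveTransitive using (ε; _◅_)
open import Relation.Binary.PropositionalEquality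
  using (_≡_; _≢_; refl; sym; trans; cong; subst; subst₂; ≢-sym; module ≡-Reasoning)
open import Relation.Nullary using (¬_; yes; no; contradiction)

private
  variable
    A : Set
    m : ℕ
    x y : A
    xs ys zs ws : List A

All-fromLookup : ∀ {P : A → Set} → (∀ i → P (lookup xs i)) → All P xs
All-fromLookup {xs = []}     _ = []
All-fromLookup {xs = x ∷ xs} f = f zero ∷ All-fromLookup (f ∘ suc)

module _ {R : Rel A 0ℓ} where

  AllPairs-lookup : AllPairs R xs → ∀ i j → toℕ i < toℕ j → R (lookup xs i) (lookup xs j)
  AllPairs-lookup (px ∷ _)  zero    (suc j) _         = All.lookup px (∈-lookup j)
  AllPairs-lookup (_ ∷ pxs) (suc i) (suc j) (s<s i<j) = AllPairs-lookup pxs i j i<j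

  AllPairs-fromLookup : (∀ i j → toℕ i < toℕ j → R (lookup xs i) (lookup xs j)) → AllPairs R xs
  AllPairs-fromLookup {xs = []}     _ = []
  AllPairs-fromLookup {xs = x ∷ xs} f =
    All-fromLookup (λ j → f zero (suc j) z<s) ∷ AllPairs-fromLookup (λ i j → f (suc i) (suc j) ∘ s<s)

  AllPairs-++⁻ : AllPairs R (xs ++ ys) → AllPairs R xs × All (λ x → All (R x) ys) xs × AllPairs R ys
  AllPairs-++⁻ {xs = []}     pys        = [] , [] , pys
  AllPairs-++⁻ {xs = x ∷ xs} (px ∷ pxs) with AllPairs-++⁻ pxs
  ... | pxs′ , cross , pys = All.++⁻ˡ xs px ∷ pxs′ , All.++⁻ʳ xs px ∷ cross , pys

  AllPairs-before : AllPairs R (xs ++ y ∷ ys) → All (λ x → R x y) xs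
  AllPairs-before {xs = []}     _          = []
  AllPairs-before {xs = x ∷ xs} (px ∷ pxs) = All.head (All.++⁻ʳ xs px) ∷ AllPairs-before pxs

  AllPairs-resp-⊆ : xs ⊆ ys → AllPairs R ys → AllPairs R xs
  AllPairs-resp-⊆ []           []         = []
  AllPairs-resp-⊆ (y ∷ʳ xs⊆)   (_ ∷ pys)  = AllPairs-resp-⊆ xs⊆ pys
  AllPairs-resp-⊆ (refl ∷ xs⊆) (py ∷ pys) = All-resp-⊆ xs⊆ py ∷ AllPairs-resp-⊆ xs⊆ pys

  strictlySorted-⊆ : Asymmetric R → AllPairs R xs → AllPairs R ys → (∀ {z} → z ∈ xs → z ∈ ys) → xs ⊆ ys
  strictlySorted-⊆ {xs = []}                _    _          _          _   = minimum _
  strictlySorted-⊆ {xs = x ∷ xs} {ys = []}     _    _          _          sub with () ← sub (here refl)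
  strictlySorted-⊆ {xs = x ∷ xs} {ys = y ∷ ys} asym (px ∷ pxs) (py ∷ pys) sub with sub (here refl)
  ... | here refl  = refl ∷ strictlySorted-⊆ asym pxs pys tail∈
    where
    tail∈ : ∀ {z} → z ∈ xs → z ∈ ys
    tail∈ z∈xs with sub (there z∈xs)
    ... | here refl = contradiction (All.lookup px z∈xs) λ r → asym r r
    ... | there z∈ys = z∈ys
  ... | there x∈ys = y ∷ʳ strictlySorted-⊆ asym (px ∷ pxs) pys all∈
    where
    all∈ : ∀ {z} → z ∈ x ∷ xs → z ∈ ys
    all∈ z∈ with sub z∈ | z∈
    ... | there z∈ys | _          = z∈ys
    ... | here refl  | here refl  = x∈ys
    ... | here refl  | there z∈xs = contradiction (All.lookup py x∈ys) (asym (All.lookup px z∈xs))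

data AllTriples {A : Set} (T : A → A → A → Set) : List A → Set where
  []  : AllTriples T []
  _∷_ : ∀ {x xs} → AllPairs (T x) xs → AllTriples T xs → AllTriples T (x ∷ xs)

module _ {T : A → A → A → Set} where

  AllTriples-lookup : AllTriples T xs → ∀ i j k → toℕ i < toℕ j → toℕ j < toℕ k →
                      T (lookup xs i) (lookup xs j) (lookup xs k)
  AllTriples-lookup (px ∷ _)  zero    (suc j) (suc k) _         (s<s j<k) = AllPairs-lookup px j k j<k
  AllTriples-lookup (_ ∷ pxs) (suc i) (suc j) (suc k) (s<s i<j) (s<s j<k) = AllTriples-lookup pxs i j k i<j j<k

  AllTriples-fromLookup : (∀ i j k → toℕ i < toℕ j → toℕ j < toℕ k →
                           T (lookup xs i) (lookup xs j) (lookup xs k)) →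
                          AllTriples T xs
  AllTriples-fromLookup {xs = []}     _ = []
  AllTriples-fromLookup {xs = x ∷ xs} f =
    AllPairs-fromLookup (λ j k → f zero (suc j) (suc k) z<s ∘ s<s) ∷
    AllTriples-fromLookup (λ i j k i<j → f (suc i) (suc j) (suc k) (s<s i<j) ∘ s<s)

  AllTriples-++⁻ʳ : AllTriples T (xs ++ ys) → AllTriples T ys
  AllTriples-++⁻ʳ {xs = []}     pys       = pys
  AllTriples-++⁻ʳ {xs = x ∷ xs} (_ ∷ pxs) = AllTriples-++⁻ʳ pxs

sublists : List A → List (List A)
sublists []       = [ [] ]
sublists (x ∷ xs) = map (x ∷_) (sublists xs) ++ sublists xs

length-sublists : ∀ (xs : List A) → length (sublists xs) ≡ 2 ^ length xs
length-sublists []       = refl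
length-sublists (x ∷ xs) = begin
  length (map (x ∷_) (sublists xs) ++ sublists xs)         ≡⟨ length-++ (map (x ∷_) (sublists xs)) ⟩
  length (map (x ∷_) (sublists xs)) + length (sublists xs) ≡⟨ cong (_+ _) (length-map (x ∷_) (sublists xs)) ⟩
  length (sublists xs) + length (sublists xs)              ≡⟨ cong (λ m → m + m) (length-sublists xs) ⟩
  2 ^ length xs + 2 ^ length xs                            ≡⟨ cong (2 ^ length xs +_) (+-identityʳ _) ⟨
  2 ^ length (x ∷ xs)                                      ∎
  where open ≡-Reasoning

∈-sublists⁺ : xs ⊆ ys → xs ∈ sublists ys
∈-sublists⁺ []             = here refl
∈-sublists⁺ (y ∷ʳ xs⊆ys)   = ∈-++⁺ʳ _ (∈-sublists⁺ xs⊆ys)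
∈-sublists⁺ (refl ∷ xs⊆ys) = ∈-++⁺ˡ (∈-map⁺ _ (∈-sublists⁺ xs⊆ys))

∈-sublists⁻ : xs ∈ sublists ys → xs ⊆ ys
∈-sublists⁻ {ys = []}     (here refl) = []
∈-sublists⁻ {ys = y ∷ ys} xs∈ with ∈-++⁻ (map (y ∷_) (sublists ys)) xs∈
... | inj₂ xs∈′ = y ∷ʳ ∈-sublists⁻ xs∈′
... | inj₁ xs∈′ with _ , xs′∈ , refl ← ∈-map⁻ (y ∷_) xs∈′ = refl ∷ ∈-sublists⁻ xs′∈

sublists-unique : Unique xs → Unique (sublists xs)
sublists-unique []           = [] ∷ []
sublists-unique {xs = x ∷ xs} (x∉xs ∷ u) =
  Unique.++⁺ (Unique.map⁺ ∷-injectiveʳ (sublists-unique u)) (sublists-unique u) disjoint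
  where
  disjoint : ∀ {zs} → ¬ (zs ∈ map (x ∷_) (sublists xs) × zs ∈ sublists xs)
  disjoint (zs∈ , zs∈′) with _ , _ , refl ← ∈-map⁻ (x ∷_) zs∈ =
    All.lookup x∉xs (Sublist.lookup (∈-sublists⁻ zs∈′) (here refl)) refl

unique-↭ : Unique xs → Unique ys → (∀ {z} → z ∈ xs ⇔ z ∈ ys) → xs ↭ ys
unique-↭ uxs uys xs≈ys = ∼bag⇒↭ (unique∧set⇒bag uxs uys xs≈ys)

_∖_ : List ℕ → List ℕ → List ℕ
xs ∖ zs = filter (_∉? zs) xs

module _ {xs zs : List ℕ} (uxs : Unique xs) (uzs : Unique zs) where

  ∖-++-unique : Unique ((xs ∖ zs) ++ zs)
  ∖-++-unique = Unique.++⁺ (Unique.filter⁺ (_∉? zs) uxs) uzs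
                  λ (z∈ , z∈zs) → proj₂ (∈-filter⁻ (_∉? zs) {xs = xs} z∈) z∈zs

  ∖-++-↭ : (∀ {z} → z ∈ zs → z ∈ xs) → (xs ∖ zs) ++ zs ↭ xs
  ∖-++-↭ zs⊆xs = unique-↭ ∖-++-unique uxs (mk⇔ to from)
    where
    to : ∀ {z} → z ∈ (xs ∖ zs) ++ zs → z ∈ xs
    to z∈ with ∈-++⁻ (xs ∖ zs) z∈
    ... | inj₁ z∈xs∖zs = proj₁ (∈-filter⁻ (_∉? zs) z∈xs∖zs)
    ... | inj₂ z∈zs    = zs⊆xs z∈zs
    from : ∀ {z} → z ∈ xs → z ∈ (xs ∖ zs) ++ zs
    from {z} z∈xs with z ∈? zs
    ... | yes z∈zs = ∈-++⁺ʳ (xs ∖ zs) z∈zs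
    ... | no  z∉zs = ∈-++⁺ˡ (∈-filter⁺ (_∉? zs) z∈xs z∉zs)

++-∷-cancelˡ : x ∉ xs → x ∉ ys → xs ++ x ∷ zs ≡ ys ++ x ∷ ws → zs ≡ ws
++-∷-cancelˡ {xs = []}     {ys = []}     _     _     eq = ∷-injectiveʳ eq
++-∷-cancelˡ {xs = []}     {ys = y ∷ ys} _     x∉ys  eq = contradiction (here (∷-injectiveˡ eq)) x∉ys
++-∷-cancelˡ {xs = z ∷ xs} {ys = []}     x∉xs  _     eq = contradiction (here (sym (∷-injectiveˡ eq))) x∉xs
++-∷-cancelˡ {xs = z ∷ xs} {ys = y ∷ ys} x∉xs  x∉ys  eq =
  ++-∷-cancelˡ (x∉xs ∘ there) (x∉ys ∘ there) (∷-injectiveʳ eq)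

∈-range1⁻ : ∀ {m z} → z ∈ range1 m → 0 < z × z ≤ m
∈-range1⁻ z∈ with _ , i∈ , refl ← ∈-map⁻ suc z∈ = z<s , ∈-upTo⁻ i∈

∈-range1⁺ : ∀ {m z} → 0 < z → z ≤ m → z ∈ range1 m
∈-range1⁺ {z = suc _} _ z≤m = ∈-map⁺ suc (∈-upTo⁺ z≤m)

range1-ascending : ∀ m → AllPairs _<_ (range1 m)
range1-ascending m = AllPairs.map⁺ (AllPairs.applyUpTo⁺₁ id m λ i<j _ → s<s i<j)

order-preserving⇔AllPairs : ∀ {_≼_ : A → A → Set} (v : List A) →
  (∀ i j → lookup v i ≼ lookup v j → toℕ i ≤ toℕ j) ⇔ AllPairs (λ a b → ¬ b ≼ a) v
order-preserving⇔AllPairs v = mk⇔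
  (λ mono → AllPairs-fromLookup λ i j i<j b≼a → <⇒≱ i<j (mono j i b≼a))
  (λ pairs i j a≼b → ≮⇒≥ λ j<i → AllPairs-lookup pairs j i j<i a≼b)

NoValley : ℕ → ℕ → ℕ → Set
NoValley a b c = ¬ (b < a × b < c)

avoids⇔noValley : ∀ {v} → Unique v → Avoids213-312 v ⇔ AllTriples NoValley v
avoids⇔noValley {v} u = mk⇔ to from
  where
  to : Avoids213-312 v → AllTriples NoValley v
  to (no213 , no312) = AllTriples-fromLookup valley
    where
    valley : ∀ i j k → toℕ i < toℕ j → toℕ j < toℕ k → NoValley (lookup v i) (lookup v j) (lookup v k)
    valley i j k i<j j<k (b<a , b<c) with <-cmp (lookup v i) (lookup v k)
    ... | tri< a<c _ _ = no213 (i , j , k , i<j , j<k , b<a , a<c)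
    ... | tri≈ _ a≡c _ = AllPairs-lookup u i k (<-trans i<j j<k) a≡c
    ... | tri> _ _ c<a = no312 (i , j , k , i<j , j<k , b<c , c<a)
  from : AllTriples NoValley v → Avoids213-312 v
  from noValley =
    (λ (i , j , k , i<j , j<k , b<a , a<c) → AllTriples-lookup noValley i j k i<j j<k (b<a , <-trans b<a a<c)) ,
    (λ (i , j , k , i<j , j<k , b<c , c<a) → AllTriples-lookup noValley i j k i<j j<k (<-trans b<c c<a , b<c))

noValleyAt : ∀ {a} → All (a <_) xs → AllPairs _>_ ys → AllPairs (NoValley a) (xs ++ ys)
noValleyAt []           ys↘ = AllPairs.map (λ c<b → <-asym c<b ∘ proj₂) ys↘
noValleyAt (a<b ∷ a<xs) ys↘ = All.tabulate (λ _ → <-asym a<b ∘ proj₁) ∷ noValleyAt a<xs ys↘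

ascending++descending⇒noValley : AllPairs _<_ xs → AllPairs _>_ ys → AllTriples NoValley (xs ++ ys)
ascending++descending⇒noValley {ys = []}    []           []        = []
ascending++descending⇒noValley {ys = _ ∷ _} []           (_ ∷ ys↘) =
  noValleyAt [] ys↘ ∷ ascending++descending⇒noValley [] ys↘
ascending++descending⇒noValley              (a<xs ∷ xs↗) ys↘       =
  noValleyAt a<xs ys↘ ∷ ascending++descending⇒noValley xs↗ ys↘

noValley⇒ascending : AllTriples NoValley (xs ++ m ∷ ys) → AllPairs _≢_ xs → All (_< m) xs → AllPairs _<_ xs
noValley⇒ascending {xs = []}     _          []         []         = []
noValley⇒ascending {xs = x ∷ xs} (vx ∷ vxs) (x≢xs ∷ u) (_ ∷ xs<m) =
  All.tabulate (λ b∈ → ascend (All.lookup (AllPairs-before vx) b∈) (All.lookup x≢xs b∈) (All.lookup xs<m b∈))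
  ∷ noValley⇒ascending vxs u xs<m
  where
  ascend : ∀ {b} → NoValley x b m → x ≢ b → b < m → x < b
  ascend nv x≢b b<m = ≤∧≢⇒< (≮⇒≥ λ b<x → nv (b<x , b<m)) x≢b

noValley⇒descending : AllPairs (NoValley m) xs → AllPairs _≢_ xs → All (_< m) xs → AllPairs _>_ xs
noValley⇒descending []          []          []          = []
noValley⇒descending (vx ∷ vxs) (x≢xs ∷ u) (x<m ∷ xs<m) =
  All.zipWith (λ (nv , x≢c) → ≤∧≢⇒< (≮⇒≥ λ x<c → nv (x<m , x<c)) (≢-sym x≢c)) (vx , x≢xs) ∷
  noValley⇒descending vxs u xs<m

module CombOrder {s t : ℕ} (t≥2 : 2 ≤ t) where

  instance
    t-nonZero : NonZero t
    t-nonZero = >-nonZero (<-trans z<s t≥2)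

  ∤-c*t+j : ∀ c j → 0 < j → j < t → ¬ t ∣ c * t + j
  ∤-c*t+j c j@(suc _) _ j<t t∣ = <⇒≱ j<t (∣⇒≤ (∣m+n∣m⇒∣n t∣ (n∣m*n c)))

  CombGen-< : ∀ {x y} → CombGen s t x y → x < y
  CombGen-< (spine c _)       = +-monoˡ-< 1 (m<n+m (c * t) (<-trans z<s t≥2))
  CombGen-< (tooth c j _ _ _) = +-monoʳ-< (c * t) (n<1+n j)

  CombGen-∤ : ∀ {x y} → CombGen s t x y → ¬ t ∣ x
  CombGen-∤ (spine c _)            = ∤-c*t+j c 1 z<s t≥2
  CombGen-∤ (tooth c j _ 1≤j j<t)  = ∤-c*t+j c j 1≤j j<t

  ≤β⇒≤ : ∀ {x y} → x ≤β[ s , t ] y → x ≤ y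
  ≤β⇒≤ ε           = ≤-refl
  ≤β⇒≤ (x⋖y ◅ y≤z) = ≤-trans (<⇒≤ (CombGen-< x⋖y)) (≤β⇒≤ y≤z)

  multiple-maximal : ∀ {x y} → t ∣ x → x ≤β[ s , t ] y → x ≡ y
  multiple-maximal _   ε           = refl
  multiple-maximal t∣x (x⋖y ◅ _)   = contradiction t∣x (CombGen-∤ x⋖y)

  nonMultiple-covered : ∀ {x} → x < s * t → ¬ t ∣ x → CombGen s t x (suc x)
  nonMultiple-covered {x} x<st t∤x = subst₂ (CombGen s t) (sym x≡) (sym suc-x≡) (tooth q r q<s 0<r (m%n<n x t))
    where
    q = x / t
    r = x % t
    x≡ : x ≡ q * t + r
    x≡ = trans (m≡m%n+[m/n]*n x t) (+-comm r (q * t))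
    suc-x≡ : suc x ≡ q * t + suc r
    suc-x≡ = trans (cong suc x≡) (sym (+-suc (q * t) r))
    0<r : 0 < r
    0<r = n≢0⇒n>0 (t∤x ∘ m%n≡0⇒n∣m x t)
    q<s : q < s
    q<s = *-cancelʳ-< t q s (≤-<-trans (subst (q * t ≤_) (sym x≡) (m≤m+n (q * t) r)) x<st)

  _≱β_ : ℕ → ℕ → Set
  a ≱β b = ¬ (b ≤β[ s , t ] a)

  <⇒≱β : ∀ {a b} → a < b → a ≱β b
  <⇒≱β a<b b≤a = <⇒≱ a<b (≤β⇒≤ b≤a)

  multiple⇒≱β : ∀ {a b} → t ∣ b → a ≢ b → a ≱β b
  multiple⇒≱β t∣b a≢b b≤a = a≢b (sym (multiple-maximal t∣b b≤a))

  ascending++multiples-≱β : ∀ {xs ys} → AllPairs _<_ xs → All (t ∣_) ys → Unique (xs ++ ys) →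
                            AllPairs _≱β_ (xs ++ ys)
  ascending++multiples-≱β {ys = []}    []           []             []         = []
  ascending++multiples-≱β {ys = _ ∷ _} []           (_ ∷ ys-mult)  (a≢ys ∷ u) =
    All.zipWith (uncurry multiple⇒≱β) (ys-mult , a≢ys) ∷ ascending++multiples-≱β [] ys-mult u
  ascending++multiples-≱β {xs = _ ∷ xs} (a<xs ∷ xs↗) ys-mult (a≢ ∷ u) =
    All.++⁺ (All.map <⇒≱β a<xs) (All.zipWith (uncurry multiple⇒≱β) (ys-mult , All.++⁻ʳ xs a≢)) ∷
    ascending++multiples-≱β xs↗ ys-mult u

  successor-∉ : ∀ {ws b qs} → AllPairs _≱β_ (ws ++ b ∷ qs) → All (_< b) qs →
                CombGen s t b (suc b) → suc b ∉ ws ++ b ∷ qs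
  successor-∉ {ws} prec qs<b b⋖sb sb∈ with ∈-++⁻ ws sb∈
  ... | inj₁ sb∈ws         = All.lookup (AllPairs-before prec) sb∈ws (b⋖sb ◅ ε)
  ... | inj₂ (here sb≡b)   = <-irrefl (sym sb≡b) (n<1+n _)
  ... | inj₂ (there sb∈qs) = <-asym (n<1+n _) (All.lookup qs<b sb∈qs)

module Extensions (k t : ℕ) (t≥2 : 2 ≤ t) where

  open CombOrder {suc k} {t} t≥2

  n : ℕ
  n = suc k * t

  multiples : List ℕ
  multiples = applyDownFrom (λ c → suc c * t) k

  ∈-multiples⁻ : ∀ {z} → z ∈ multiples → t ∣ z × 0 < z × z < n
  ∈-multiples⁻ z∈ with c , c<k , refl ← ∈-applyDownFrom⁻ (λ c → suc c * t) z∈ =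
    divides (suc c) refl , *-monoˡ-< t {0} {suc c} z<s , *-monoˡ-< t (s<s c<k)

  ∈-multiples⁺ : ∀ {z} → t ∣ z → 0 < z → z < n → z ∈ multiples
  ∈-multiples⁺ (divides (suc c) refl) _ z<n =
    ∈-applyDownFrom⁺ (λ c → suc c * t) (s<s⁻¹ (*-cancelʳ-< t (suc c) (suc k) z<n))

  multiples-descending : AllPairs _>_ multiples
  multiples-descending = AllPairs.applyDownFrom⁺₁ _ k λ j<i _ → *-monoˡ-< t (s<s j<i)

  prefix : List ℕ → List ℕ
  prefix B = range1 n ∖ (n ∷ B)

  extension : List ℕ → List ℕ
  extension B = prefix B ++ n ∷ B

  prefix-ascending : ∀ B → AllPairs _<_ (prefix B)
  prefix-ascending B = AllPairs.filter⁺ (_∉? (n ∷ B)) (range1-ascending n)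

  ∈-prefix⁻ : ∀ {B z} → z ∈ prefix B → (0 < z × z < n) × z ∉ B
  ∈-prefix⁻ {B} z∈ with z∈range , z∉nB ← ∈-filter⁻ (_∉? (n ∷ B)) {xs = range1 n} z∈ =
    (proj₁ (∈-range1⁻ z∈range) , ≤∧≢⇒< (proj₂ (∈-range1⁻ z∈range)) (z∉nB ∘ here)) , z∉nB ∘ there

  extension-injective : ∀ {B B′} → extension B ≡ extension B′ → B ≡ B′
  extension-injective = ++-∷-cancelˡ n∉prefix n∉prefix
    where
    n∉prefix : ∀ {B} → n ∉ prefix B
    n∉prefix n∈ = <-irrefl refl (proj₂ (proj₁ (∈-prefix⁻ n∈)))

  0<n : 0 < n
  0<n = *-monoˡ-< t {0} {suc k} z<s

  range1-unique : Unique (range1 n)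
  range1-unique = AllPairs.map <⇒≢ (range1-ascending n)

  module Sound {B} (B⊆ : B ⊆ multiples) where

    B↘ : AllPairs _>_ B
    B↘ = AllPairs-resp-⊆ B⊆ multiples-descending

    B-multiples : ∀ {z} → z ∈ B → t ∣ z × 0 < z × z < n
    B-multiples = ∈-multiples⁻ ∘ Sublist.lookup B⊆

    nB-unique : Unique (n ∷ B)
    nB-unique = All.tabulate (λ z∈B → >⇒≢ (proj₂ (proj₂ (B-multiples z∈B)))) ∷ AllPairs.map >⇒≢ B↘

    nB⊆range : ∀ {z} → z ∈ n ∷ B → z ∈ range1 n
    nB⊆range (here refl)  = ∈-range1⁺ 0<n ≤-refl
    nB⊆range (there z∈B) with _ , 0<z , z<n ← B-multiples z∈B = ∈-range1⁺ 0<z (<⇒≤ z<n)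

    unique : Unique (extension B)
    unique = ∖-++-unique range1-unique nB-unique

    prefix++n-ascending : AllPairs _<_ (prefix B ++ [ n ])
    prefix++n-ascending = AllPairs.++⁺ (prefix-ascending B) ([] ∷ [])
                           (All.tabulate λ z∈ → proj₂ (proj₁ (∈-prefix⁻ z∈)) ∷ [])

    reassoc : (prefix B ++ [ n ]) ++ B ≡ extension B
    reassoc = ++-assoc (prefix B) [ n ] B

    prec : AllPairs _≱β_ (extension B)
    prec = subst (AllPairs _≱β_) reassoc (ascending++multiples-≱β prefix++n-ascending
             (All.tabulate (proj₁ ∘ B-multiples)) (subst Unique (sym reassoc) unique))

    isLinExt : IsLinExt (suc k) t (extension B)
    isLinExt = ∖-++-↭ range1-unique nB-unique nB⊆range ,
               Equivalence.from (order-preserving⇔AllPairs (extension B)) prec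

    avoids : Avoids213-312 (extension B)
    avoids = Equivalence.from (avoids⇔noValley unique)
               (subst (AllTriples NoValley) reassoc (ascending++descending⇒noValley prefix++n-ascending B↘))

  module Complete {A B} (lin : IsLinExt (suc k) t (A ++ n ∷ B)) (av : Avoids213-312 (A ++ n ∷ B)) where

    prec : AllPairs _≱β_ (A ++ n ∷ B)
    prec = Equivalence.to (order-preserving⇔AllPairs (A ++ n ∷ B)) (proj₂ lin)

    unique : Unique (A ++ n ∷ B)
    unique = AllPairs.map (λ { a≱b refl → a≱b ε }) prec

    bounds : ∀ {z} → z ∈ A ++ n ∷ B → 0 < z × z ≤ n
    bounds = ∈-range1⁻ ∘ ∈-resp-↭ (proj₁ lin)

    fill : ∀ {z} → 0 < z → z ≤ n → z ∈ A ++ n ∷ B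
    fill 0<z z≤n′ = ∈-resp-↭ (↭-sym (proj₁ lin)) (∈-range1⁺ 0<z z≤n′)

    A-unique : Unique A
    A-unique = proj₁ (AllPairs-++⁻ unique)

    A∉nB : All (λ a → All (a ≢_) (n ∷ B)) A
    A∉nB = proj₁ (proj₂ (AllPairs-++⁻ unique))

    n∉B : All (n ≢_) B
    n∉B = AllPairs.head (proj₂ (proj₂ (AllPairs-++⁻ unique)))

    B-unique : Unique B
    B-unique = AllPairs.tail (proj₂ (proj₂ (AllPairs-++⁻ unique)))

    A<n : All (_< n) A
    A<n = All.tabulate λ a∈A → ≤∧≢⇒< (proj₂ (bounds (∈-++⁺ˡ a∈A))) (All.head (All.lookup A∉nB a∈A))

    B<n : All (_< n) B
    B<n = All.tabulate λ b∈B → ≤∧≢⇒< (proj₂ (bounds (∈-++⁺ʳ A (there b∈B)))) (≢-sym (All.lookup n∉B b∈B))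

    noValley : AllTriples NoValley (A ++ n ∷ B)
    noValley = Equivalence.to (avoids⇔noValley unique) av

    A↗ : AllPairs _<_ A
    A↗ = noValley⇒ascending noValley A-unique A<n

    B↘ : AllPairs _>_ B
    B↘ with nvB ∷ _ ← AllTriples-++⁻ʳ {xs = A} noValley = noValley⇒descending nvB B-unique B<n

    B-multiple : ∀ {b} → b ∈ B → t ∣ b
    B-multiple {b} b∈B with t ∣? b | ∈-∃++ b∈B
    ... | yes t∣b | _            = t∣b
    ... | no  t∤b | B₁ , B₂ , B≡ =
      contradiction (subst (suc b ∈_) split (fill z<s b<n))
        (successor-∉ (subst (AllPairs _≱β_) split prec) B₂<b (nonMultiple-covered b<n t∤b))
      where
      b<n : b < n
      b<n = All.lookup B<n b∈B
      split : A ++ n ∷ B ≡ (A ++ n ∷ B₁) ++ b ∷ B₂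
      split = trans (cong (λ B → A ++ n ∷ B) B≡) (sym (++-assoc A (n ∷ B₁) (b ∷ B₂)))
      B₂<b : All (_< b) B₂
      B₂<b = AllPairs.head (proj₂ (proj₂ (AllPairs-++⁻ {xs = B₁} (subst (AllPairs _>_) B≡ B↘))))

    B⊆multiples : B ⊆ multiples
    B⊆multiples = strictlySorted-⊆ <-asym B↘ multiples-descending λ b∈B →
      ∈-multiples⁺ (B-multiple b∈B) (proj₁ (bounds (∈-++⁺ʳ A (there b∈B)))) (All.lookup B<n b∈B)

    A≡prefix : A ≡ prefix B
    A≡prefix = ⊆-antisym (strictlySorted-⊆ <-asym A↗ (prefix-ascending B) A⊆prefix)
                        (strictlySorted-⊆ <-asym (prefix-ascending B) A↗ prefix⊆A)
      where
      A⊆prefix : ∀ {z} → z ∈ A → z ∈ prefix B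
      A⊆prefix z∈A = ∈-filter⁺ (_∉? (n ∷ B)) (uncurry ∈-range1⁺ (bounds (∈-++⁺ˡ z∈A)))
                      λ z∈nB → All.lookup (All.lookup A∉nB z∈A) z∈nB refl
      prefix⊆A : ∀ {z} → z ∈ prefix B → z ∈ A
      prefix⊆A z∈ with (0<z , z<n) , z∉B ← ∈-prefix⁻ z∈ with ∈-++⁻ A (fill 0<z (<⇒≤ z<n))
      ... | inj₁ z∈A         = z∈A
      ... | inj₂ (here refl) = contradiction z<n (<-irrefl refl)
      ... | inj₂ (there z∈B) = contradiction z∈B z∉B

    is-extension : A ++ n ∷ B ≡ extension B
    is-extension = cong (_++ n ∷ B) A≡prefix

  avoidingExtensions : List (List ℕ)
  avoidingExtensions = map extension (sublists multiples)

  avoidingExtensions-unique : Unique avoidingExtensions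
  avoidingExtensions-unique =
    Unique.map⁺ extension-injective (sublists-unique (AllPairs.map >⇒≢ multiples-descending))

  ∈-avoidingExtensions⁻ : ∀ {v} → v ∈ avoidingExtensions → IsLinExt (suc k) t v × Avoids213-312 v
  ∈-avoidingExtensions⁻ v∈ with B , B∈ , refl ← ∈-map⁻ extension v∈ =
    Sound.isLinExt (∈-sublists⁻ B∈) , Sound.avoids (∈-sublists⁻ B∈)

  ∈-avoidingExtensions⁺ : ∀ {v} → IsLinExt (suc k) t v × Avoids213-312 v → v ∈ avoidingExtensions
  ∈-avoidingExtensions⁺ (lin , av)
    with A , B , refl ← ∈-∃++ (∈-resp-↭ (↭-sym (proj₁ lin)) (∈-range1⁺ 0<n ≤-refl)) =
    subst (_∈ avoidingExtensions) (sym (Complete.is-extension lin av))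
      (∈-map⁺ extension (∈-sublists⁺ (Complete.B⊆multiples lin av)))

  length-avoidingExtensions : length avoidingExtensions ≡ 2 ^ k
  length-avoidingExtensions = begin
    length (map extension (sublists multiples)) ≡⟨ length-map extension (sublists multiples) ⟩
    length (sublists multiples)                 ≡⟨ length-sublists multiples ⟩
    2 ^ length multiples                        ≡⟨ cong (2 ^_) (length-applyDownFrom _ k) ⟩
    2 ^ k                                       ∎
    where open ≡-Reasoning

theorem18 : ∀ (s t : ℕ) → 1 ≤ s → 2 ≤ t →
    ∃[ L ] (Unique L ×
            (∀ (v : List ℕ) → v ∈ L ⇔ (IsLinExt s t v × Avoids213-312 v)) ×
            length L ≡ 2 ^ (s ∸ 1))
theorem18 zero    _ () _
theorem18 (suc k) t _  t≥2 =
  avoidingExtensions ,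
  avoidingExtensions-unique ,
  (λ v → mk⇔ ∈-avoidingExtensions⁻ ∈-avoidingExtensions⁺) ,
  length-avoidingExtensions
  where open Extensions k t t≥2
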